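{- Let $H$ be a graph of minimum degree at least three, and let $N$ be a graph obtained from $H$ by repeatedly contracting edges, where each contracted edge belongs to no triangle of the current graph at the time it is contracted. Then $|E(H)|\le 3|E(N)|$.
   Context: All graphs are finite and simple. Contracting an edge $xy$ means deleting it and identifying $x$ and $y$ into a single vertex (no parallel edges arise when $xy$ lies in no triangle). -}

module Defs where

open import Data.Nat using (ℕ; zero; suc; _+_; _<ᵇ_)
open import Data.Bool using (Bool; true; false; if_then_else_; _∧_)
open import Data.Fin using (Fin; zero; suc; toℕ)
open import Data.Product using (Σ; ∃; _×_; _,_)
open import Data.Sum using (_⊎_)
open import Relation.Nullary using (¬_)
open import Relation.Binary.PropositionalEquality using (_≡_; _≢_)
open import Function.Bundles using (_⇔_)
open import Relation.Binary.Construct.Closure.ReflexiveTransitive using (Star)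

record Graph : Set where
  field
    order : ℕ
    adj   : Fin order → Fin order → Bool
    adj-sym : ∀ u v → adj u v ≡ adj v u
    adj-irr : ∀ u → adj u u ≡ false
open Graph public

count : ∀ {n} → (Fin n → Bool) → ℕ
count {zero}  p = 0
count {suc n} p = (if p zero then 1 else 0) + count (λ i → p (suc i))

deg : (G : Graph) → Fin (order G) → ℕ
deg G u = count (adj G u)

sumFin : ∀ {n} → (Fin n → ℕ) → ℕ
sumFin {zero}  f = 0
sumFin {suc n} f = f zero + sumFin (λ i → f (suc i))

numEdges : Graph → ℕ
numEdges G = sumFin (λ u → count (λ v → (toℕ u <ᵇ toℕ v) ∧ adj G u v))

MinDegreeAtLeast : ℕ → Graph → Set
MinDegreeAtLeast k G = ∀ u → k Data.Nat.≤ deg G u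

-- N is (isomorphic to) the graph obtained from G by contracting the edge xy:
-- f : V(G) → V(N) is surjective, identifies exactly x and y, and
-- two vertices of N are adjacent iff they are distinct and have adjacent preimages.
record IsContraction (G N : Graph) (x y : Fin (order G)) : Set where
  field
    f        : Fin (order G) → Fin (order N)
    f-surj   : ∀ w → ∃ λ u → f u ≡ w
    f-xy     : f x ≡ f y
    f-only   : ∀ u v → f u ≡ f v → (u ≡ v) ⊎ ((u ≡ x × v ≡ y) ⊎ (u ≡ y × v ≡ x))
    f-adj    : ∀ u v → (adj N (f u) (f v) ≡ true) ⇔
                 ((f u ≢ f v) × ∃ λ u' → ∃ λ v' →
                    (f u' ≡ f u) × (f v' ≡ f v) × (adj G u' v' ≡ true))

data ContractStep (G N : Graph) : Set where
  step : (x y : Fin (order G)) →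
         adj G x y ≡ true →
         (∀ z → ¬ (adj G x z ≡ true × adj G y z ≡ true)) →
         IsContraction G N x y →
         ContractStep G N

TriangleFreeContractible : Graph → Graph → Set
TriangleFreeContractible = Star ContractStep

module Submission where

-- Count edges and vertices along the contraction sequence.
-- Contracting an edge xy removes a vertex, and because xy lies in
-- no triangle it destroys only the edge xy itself: every other edge of G
-- survives, and distinct surviving edges stay distinct in the contracted
-- graph N.  Hence |E(G)| ≤ 1 + |E(N)| and |V(N)| < |V(G)| for every step,
-- and along the whole sequence |E(H)| + |V(N)| ≤ |E(N)| + |V(H)|.  With
-- minimum degree three, the handshake lemma gives 3|V(H)| ≤ 2|E(H)|, and
-- the two inequalities combine to |E(H)| ≤ 3|E(N)|.

open import Defs
open import Data.Nat using (ℕ; zero; suc; _+_; _*_; _≤_; _<_; _<ᵇ_; z≤n; s≤s)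
open import Data.Nat.Properties as NP using (+-assoc; +-suc; +-identityʳ; ≤-refl; ≤-trans; +-mono-≤; <ᵇ⇒<; <⇒<ᵇ; <-cmp)
open import Data.Bool using (Bool; true; false; if_then_else_; _∧_)
open import Data.Bool.Properties using (T-≡; ¬-not)
open import Data.Fin as F using (Fin; zero; suc; toℕ; _↑ˡ_; _↑ʳ_; combine; remQuot; punchIn; punchOut)
open import Data.Fin.Properties using (remQuot-combine; combine-remQuot; combine-injective; punchIn-punchOut; punchOut-injective; injective⇒≤; toℕ-injective; suc-injective)
open import Data.Product using (Σ; _×_; _,_; proj₁; proj₂; uncurry)
open import Data.Product.Properties using (≡-dec)
open import Data.Sum using (inj₁; inj₂)
open import Data.Empty using (⊥; ⊥-elim)
open import Relation.Nullary using (¬_; yes; no)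
open import Relation.Binary.PropositionalEquality using (_≡_; _≢_; refl; sym; trans; cong; subst; subst₂; module ≡-Reasoning)
open import Relation.Binary.Definitions using (tri<; tri≈; tri>)
open import Function.Bundles using (Equivalence)
open import Relation.Binary.Construct.Closure.ReflexiveTransitive using (ε; _◅_)
open import Algebra.Properties.CommutativeMonoid.Sum NP.+-0-commutativeMonoid using (sum; sum-cong-≗; ∑-distrib-+; ∑-comm)

⟦_⟧ : Bool → ℕ
⟦ b ⟧ = if b then 1 else 0

-- The sum of Defs agrees with the standard library's sum over vectors,
-- whose algebraic laws (congruence, linearity, Fubini) we reuse.
sumFin-is-sum : ∀ {n} (f : Fin n → ℕ) → sumFin f ≡ sum f
sumFin-is-sum {zero}  f = refl
sumFin-is-sum {suc n} f = cong (f zero +_) (sumFin-is-sum (λ i → f (suc i)))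

count-is-sum : ∀ {n} (p : Fin n → Bool) → count p ≡ sum (λ i → ⟦ p i ⟧)
count-is-sum {zero}  p = refl
count-is-sum {suc n} p = cong (⟦ p zero ⟧ +_) (count-is-sum (λ i → p (suc i)))

sum-split : ∀ m {n} (h : Fin (m + n) → ℕ) →
  sum h ≡ sum (λ i → h (i ↑ˡ n)) + sum (λ j → h (m ↑ʳ j))
sum-split zero    h = refl
sum-split (suc m) h rewrite sum-split m (λ i → h (suc i)) = sym (+-assoc (h zero) _ _)

sum-combine : ∀ m n (h : Fin (m * n) → ℕ) →
  sum h ≡ sum {m} (λ i → sum {n} (λ j → h (combine i j)))
sum-combine zero    n h = refl
sum-combine (suc m) n h rewrite sum-split n h =
  cong (sum (λ j → h (j ↑ˡ (m * n))) +_) (sum-combine m n (λ k → h (n ↑ʳ k)))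

sum-count-pairs : ∀ m n (g : Fin m → Fin n → Bool) →
  sum (λ i → count (g i)) ≡ count {m * n} (λ k → uncurry g (remQuot n k))
sum-count-pairs m n g = begin
    sum (λ i → count (g i))
  ≡⟨ sum-cong-≗ (λ i → count-is-sum (g i)) ⟩
    sum (λ i → sum (λ j → ⟦ g i j ⟧))
  ≡⟨ sum-cong-≗ (λ i → sum-cong-≗ (λ j → cong (λ p → ⟦ uncurry g p ⟧) (sym (remQuot-combine {m} {n} i j)))) ⟩
    sum {m} (λ i → sum {n} (λ j → ⟦ uncurry g (remQuot n (combine {m} {n} i j)) ⟧))
  ≡⟨ sym (sum-combine m n (λ k → ⟦ uncurry g (remQuot n k) ⟧)) ⟩
    sum (λ k → ⟦ uncurry g (remQuot n k) ⟧)
  ≡⟨ sym (count-is-sum (λ k → uncurry g (remQuot n k))) ⟩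
    count (λ k → uncurry g (remQuot n k))
  ∎
  where open ≡-Reasoning

sum-lower-bound : ∀ {n} k (f : Fin n → ℕ) → (∀ i → k ≤ f i) → n * k ≤ sum f
sum-lower-bound {zero}  k f lb = z≤n
sum-lower-bound {suc n} k f lb = +-mono-≤ (lb zero) (sum-lower-bound k (λ i → f (suc i)) (λ i → lb (suc i)))

count-punchIn : ∀ {b} (Q : Fin (suc b) → Bool) j → Q j ≡ true →
  count Q ≡ suc (count (λ k → Q (punchIn j k)))
count-punchIn Q zero e rewrite e = refl
count-punchIn {suc b} Q (suc j) e =
  trans (cong (⟦ Q zero ⟧ +_) (count-punchIn (λ k → Q (suc k)) j e)) (+-suc ⟦ Q zero ⟧ _)

count-≤-by-injection : ∀ {a b} (P : Fin a → Bool) (Q : Fin b → Bool)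
  (h : (i : Fin a) → P i ≡ true → Fin b) →
  (∀ i p → Q (h i p) ≡ true) → (∀ i j p q → h i p ≡ h j q → i ≡ j) → count P ≤ count Q
count-≤-by-injection {zero} P Q h hQ h-inj = z≤n
count-≤-by-injection {suc a} {b} P Q h hQ h-inj with P zero in P0
... | false = count-≤-by-injection (λ i → P (suc i)) Q (λ i p → h (suc i) p) (λ i p → hQ (suc i) p)
                (λ i j p q eq → suc-injective (h-inj (suc i) (suc j) p q eq))
count-≤-by-injection {suc a} {zero} P Q h hQ h-inj | true with h zero P0
... | ()
count-≤-by-injection {suc a} {suc b} P Q h hQ h-inj | true =
  subst (suc (count (λ i → P (suc i))) ≤_) (sym (count-punchIn Q j₀ (hQ zero P0)))
    (s≤s (count-≤-by-injection (λ i → P (suc i)) (λ k → Q (punchIn j₀ k)) h′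
       (λ i p → trans (cong Q (punchIn-punchOut (avoids-j₀ i p))) (hQ (suc i) p))
       (λ i j p q eq → suc-injective (h-inj (suc i) (suc j) p q
                          (punchOut-injective (avoids-j₀ i p) (avoids-j₀ j q) eq)))))
  where
  j₀ = h zero P0
  avoids-j₀ : ∀ i p → j₀ ≢ h (suc i) p
  avoids-j₀ i p eq with h-inj zero (suc i) P0 p eq
  ... | ()
  h′ : ∀ i → P (suc i) ≡ true → Fin b
  h′ i p = punchOut (avoids-j₀ i p)

injection-missing-value : ∀ {m n} (y : Fin m) (g : Fin n → Fin m) → (∀ w → y ≢ g w) →
  (∀ {a b} → g a ≡ g b → a ≡ b) → n < m
injection-missing-value {zero}  () g misses inj
injection-missing-value {suc m} y g misses inj = s≤s (injective⇒≤ {f = λ w → punchOut (misses w)}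
  (λ eq → inj (punchOut-injective (misses _) (misses _) eq)))

no-loop : (G : Graph) {z : Fin (order G)} → adj G z z ≢ true
no-loop G {z} a with trans (sym a) (adj-irr G z)
... | ()

degree-sum : Graph → ℕ
degree-sum G = sum (deg G)

arcs : (G : Graph) → Fin (order G * order G) → Bool
arcs G k = uncurry (adj G) (remQuot (order G) k)

degree-sum-counts-arcs : (G : Graph) → degree-sum G ≡ count (arcs G)
degree-sum-counts-arcs G = sum-count-pairs (order G) (order G) (adj G)

_≺_ : ∀ {n} → Fin n → Fin n → Bool
u ≺ v = toℕ u <ᵇ toℕ v

≺-true : ∀ {n} {u v : Fin n} → toℕ u < toℕ v → (u ≺ v) ≡ true
≺-true u<v = Equivalence.to T-≡ (<⇒<ᵇ u<v)

≺-false : ∀ {n} {u v : Fin n} → ¬ toℕ u < toℕ v → (u ≺ v) ≡ false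
≺-false {u = u} {v} u≮v = ¬-not (λ e → u≮v (<ᵇ⇒< (toℕ u) (toℕ v) (Equivalence.from T-≡ e)))

-- Every arc is oriented either upwards or downwards, never both (the
-- diagonal carries no arc).
arc-orientation : (G : Graph) (u v : Fin (order G)) →
  ⟦ adj G u v ⟧ ≡ ⟦ (u ≺ v) ∧ adj G u v ⟧ + ⟦ (v ≺ u) ∧ adj G v u ⟧
arc-orientation G u v rewrite adj-sym G v u with <-cmp (toℕ u) (toℕ v)
... | tri< u<v _ v≮u rewrite ≺-true {u = u} {v} u<v | ≺-false {u = v} {u} v≮u = sym (+-identityʳ _)
... | tri> u≮v _ v<u rewrite ≺-false {u = u} {v} u≮v | ≺-true {u = v} {u} v<u = refl
... | tri≈ _ u≡v _ rewrite toℕ-injective u≡v | adj-irr G v | ≺-false {u = v} {v} (NP.<-irrefl refl) = refl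

handshake : (G : Graph) → degree-sum G ≡ 2 * numEdges G
handshake G = begin
    sum (λ u → count (adj G u))
  ≡⟨ sum-cong-≗ (λ u → trans (count-is-sum (adj G u)) (sum-cong-≗ (arc-orientation G u))) ⟩
    sum (λ u → sum (λ v → ⟦ (u ≺ v) ∧ adj G u v ⟧ + ⟦ (v ≺ u) ∧ adj G v u ⟧))
  ≡⟨ sum-cong-≗ (λ u → ∑-distrib-+ (λ v → ⟦ (u ≺ v) ∧ adj G u v ⟧) (λ v → ⟦ (v ≺ u) ∧ adj G v u ⟧)) ⟩
    sum (λ u → up u + sum (λ v → ⟦ (v ≺ u) ∧ adj G v u ⟧))
  ≡⟨ ∑-distrib-+ up (λ u → sum (λ v → ⟦ (v ≺ u) ∧ adj G v u ⟧)) ⟩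
    sum up + sum (λ u → sum (λ v → ⟦ (v ≺ u) ∧ adj G v u ⟧))
  ≡⟨ cong (sum up +_) (∑-comm (λ u v → ⟦ (v ≺ u) ∧ adj G v u ⟧)) ⟩
    sum up + sum up
  ≡⟨ cong (sum up +_) (sym (+-identityʳ (sum up))) ⟩
    2 * sum up
  ≡⟨ cong (2 *_) up-counts-edges ⟩
    2 * numEdges G
  ∎
  where
  open ≡-Reasoning
  up : Fin (order G) → ℕ
  up u = sum (λ v → ⟦ (u ≺ v) ∧ adj G u v ⟧)
  up-counts-edges : sum up ≡ numEdges G
  up-counts-edges = sym (trans (sumFin-is-sum (λ u → count (λ v → (u ≺ v) ∧ adj G u v))) (sum-cong-≗ (λ u → count-is-sum (λ v → (u ≺ v) ∧ adj G u v))))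

min-degree-edges : ∀ k (G : Graph) → MinDegreeAtLeast k G → k * order G ≤ 2 * numEdges G
min-degree-edges k G md = subst₂ _≤_ (NP.*-comm (order G) k) (handshake G) (sum-lower-bound k (deg G) md)

module Contraction {G N : Graph} {x y : Fin (order G)} (xy-edge : adj G x y ≡ true)
  (no-triangle : ∀ z → ¬ (adj G x z ≡ true × adj G y z ≡ true))
  (C : IsContraction G N x y) where
  open IsContraction C

  x≢y : x ≢ y
  x≢y refl = no-loop G xy-edge

  -- Every vertex of N has a preimage other than y (replace y by x).
  preimage-avoiding-y : ∀ w → Σ (Fin (order G)) (λ u → y ≢ u × f u ≡ w)
  preimage-avoiding-y w with proj₁ (f-surj w) F.≟ y
  ... | yes u≡y = x , (λ y≡x → x≢y (sym y≡x)) , trans f-xy (trans (cong f (sym u≡y)) (proj₂ (f-surj w)))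
  ... | no  u≢y = proj₁ (f-surj w) , (λ y≡u → u≢y (sym y≡u)) , proj₂ (f-surj w)

  -- Contraction removes a vertex: this choice of preimages is an injection
  -- V(N) → V(G) that misses y.
  order-drops : order N < order G
  order-drops = injection-missing-value y (λ w → proj₁ (preimage-avoiding-y w))
    (λ w → proj₁ (proj₂ (preimage-avoiding-y w)))
    (λ {a} {b} eq → trans (sym (proj₂ (proj₂ (preimage-avoiding-y a))))
                      (trans (cong f eq) (proj₂ (proj₂ (preimage-avoiding-y b)))))

  data ArcKind (u v : Fin (order G)) : Set where
    arc-xy : (u , v) ≡ (x , y) → ArcKind u v
    arc-yx : (u , v) ≡ (y , x) → ArcKind u v
    other  : (u , v) ≢ (x , y) → (u , v) ≢ (y , x) → ArcKind u v

  kind : ∀ u v → ArcKind u v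
  kind u v with ≡-dec F._≟_ F._≟_ (u , v) (x , y) | ≡-dec F._≟_ F._≟_ (u , v) (y , x)
  ... | yes is-xy | _         = arc-xy is-xy
  ... | no  _     | yes is-yx = arc-yx is-yx
  ... | no  not-xy | no not-yx = other not-xy not-yx

  other-arc-separated : ∀ {u v} → adj G u v ≡ true →
    (u , v) ≢ (x , y) → (u , v) ≢ (y , x) → f u ≢ f v
  other-arc-separated {u} {v} a not-xy not-yx eq with f-only u v eq
  ... | inj₁ refl                = no-loop G a
  ... | inj₂ (inj₁ (refl , refl)) = not-xy refl
  ... | inj₂ (inj₂ (refl , refl)) = not-yx refl

  no-common-neighbour : ∀ z → adj G z x ≡ true → adj G z y ≡ true → ⊥
  no-common-neighbour z zx zy = no-triangle z (trans (adj-sym G x z) zx , trans (adj-sym G y z) zy)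

  -- Two different lifts would differ by swapping x and y at one
  -- end, producing a common neighbour of x and y.
  surviving-arcs-lift-uniquely : ∀ {u v u′ v′} → adj G u v ≡ true → adj G u′ v′ ≡ true →
    (u , v) ≢ (x , y) → (u , v) ≢ (y , x) → f u ≡ f u′ → f v ≡ f v′ → (u , v) ≡ (u′ , v′)
  surviving-arcs-lift-uniquely {u} {v} {u′} {v′} a a′ not-xy not-yx fu fv
    with f-only u u′ fu | f-only v v′ fv
  ... | inj₁ refl | inj₁ refl = refl
  ... | inj₁ refl | inj₂ (inj₁ (refl , refl)) = ⊥-elim (no-common-neighbour u a a′)
  ... | inj₁ refl | inj₂ (inj₂ (refl , refl)) = ⊥-elim (no-common-neighbour u a′ a)
  ... | inj₂ (inj₁ (refl , refl)) | inj₁ refl =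
    ⊥-elim (no-common-neighbour v (trans (adj-sym G v x) a) (trans (adj-sym G v y) a′))
  ... | inj₂ (inj₂ (refl , refl)) | inj₁ refl =
    ⊥-elim (no-common-neighbour v (trans (adj-sym G v x) a′) (trans (adj-sym G v y) a))
  ... | inj₂ (inj₁ (refl , refl)) | inj₂ (inj₁ (refl , refl)) = ⊥-elim (no-loop G a)
  ... | inj₂ (inj₁ (refl , refl)) | inj₂ (inj₂ (refl , refl)) = ⊥-elim (not-xy refl)
  ... | inj₂ (inj₂ (refl , refl)) | inj₂ (inj₁ (refl , refl)) = ⊥-elim (not-yx refl)
  ... | inj₂ (inj₂ (refl , refl)) | inj₂ (inj₂ (refl , refl)) = ⊥-elim (no-loop G a)

  -- Arcs of G are encoded into two reserved slots (for xy and yx) followed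
  -- by the ordered pairs of vertices of N.
  Slot : Set
  Slot = Fin (2 + order N * order N)

  occupied : Slot → Bool
  occupied zero          = true
  occupied (suc zero)    = true
  occupied (suc (suc k)) = arcs N k

  encode : ∀ {u v} → ArcKind u v → Slot
  encode (arc-xy _)          = zero
  encode (arc-yx _)          = suc zero
  encode {u} {v} (other _ _) = suc (suc (combine (f u) (f v)))

  encode-occupied : ∀ {u v} (c : ArcKind u v) → adj G u v ≡ true → occupied (encode c) ≡ true
  encode-occupied (arc-xy _) a = refl
  encode-occupied (arc-yx _) a = refl
  encode-occupied {u} {v} (other not-xy not-yx) a =
    subst (λ p → uncurry (adj N) p ≡ true) (sym (remQuot-combine {order N} {order N} (f u) (f v)))
      (Equivalence.from (f-adj u v) (other-arc-separated a not-xy not-yx , u , v , refl , refl , a))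

  encode-injective : ∀ {u v u′ v′} (c : ArcKind u v) (c′ : ArcKind u′ v′) →
    adj G u v ≡ true → adj G u′ v′ ≡ true → encode c ≡ encode c′ → (u , v) ≡ (u′ , v′)
  encode-injective (arc-xy p) (arc-xy p′) a a′ eq = trans p (sym p′)
  encode-injective (arc-yx p) (arc-yx p′) a a′ eq = trans p (sym p′)
  encode-injective {u} {v} {u′} {v′} (other not-xy not-yx) (other _ _) a a′ eq =
    let (fu , fv) = combine-injective (f u) (f v) (f u′) (f v′) (suc-injective (suc-injective eq))
    in surviving-arcs-lift-uniquely a a′ not-xy not-yx fu fv
  encode-injective (arc-xy _) (arc-yx _)  a a′ ()
  encode-injective (arc-xy _) (other _ _) a a′ ()
  encode-injective (arc-yx _) (arc-xy _)  a a′ ()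
  encode-injective (arc-yx _) (other _ _) a a′ ()
  encode-injective (other _ _) (arc-xy _) a a′ ()
  encode-injective (other _ _) (arc-yx _) a a′ ()

  arcs-drop : count (arcs G) ≤ 2 + count (arcs N)
  arcs-drop = count-≤-by-injection (arcs G) occupied (λ k _ → encode (kindAt k))
    (λ k a → encode-occupied (kindAt k) a)
    (λ i j a a′ eq → trans (sym (combine-remQuot {order G} (order G) i))
      (trans (cong (uncurry combine) (encode-injective (kindAt i) (kindAt j) a a′ eq))
             (combine-remQuot {order G} (order G) j)))
    where
    ends : Fin (order G * order G) → Fin (order G) × Fin (order G)
    ends = remQuot {order G} (order G)
    kindAt : (k : Fin (order G * order G)) → ArcKind (proj₁ (ends k)) (proj₂ (ends k))
    kindAt k = kind (proj₁ (ends k)) (proj₂ (ends k))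

  edges-drop : numEdges G ≤ 1 + numEdges N
  edges-drop = NP.*-cancelˡ-≤ 2 (begin
      2 * numEdges G          ≡⟨ sym (handshake G) ⟩
      degree-sum G            ≡⟨ degree-sum-counts-arcs G ⟩
      count (arcs G)          ≤⟨ arcs-drop ⟩
      2 + count (arcs N)      ≡⟨ cong (2 +_) (sym (degree-sum-counts-arcs N)) ⟩
      2 + degree-sum N        ≡⟨ cong (2 +_) (handshake N) ⟩
      2 + 2 * numEdges N      ≡⟨ sym (NP.*-distribˡ-+ 2 1 (numEdges N)) ⟩
      2 * (1 + numEdges N)    ∎)
    where open NP.≤-Reasoning

-- Along a sequence of triangle-free contractions, each step removes one
-- vertex and at most one edge, so edges drop by at most as much as vertices.
edges-drop-along : (H N : Graph) → TriangleFreeContractible H N →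
  numEdges H + order N ≤ numEdges N + order H
edges-drop-along H .H ε = ≤-refl
edges-drop-along H N (_◅_ {j = G} (step x y xy-edge no-triangle C) rest) = begin
    numEdges H + order N        ≤⟨ NP.+-monoˡ-≤ (order N) (Contraction.edges-drop xy-edge no-triangle C) ⟩
    suc (numEdges G + order N)  ≤⟨ s≤s (edges-drop-along G N rest) ⟩
    suc (numEdges N + order G)  ≡⟨ sym (+-suc (numEdges N) (order G)) ⟩
    numEdges N + suc (order G)  ≤⟨ NP.+-monoʳ-≤ (numEdges N) (Contraction.order-drops xy-edge no-triangle C) ⟩
    numEdges N + order H        ∎
  where open NP.≤-Reasoning

edge-bound-arithmetic : ∀ a b n m → a + m ≤ b + n → 3 * n ≤ 2 * a → a ≤ 3 * b
edge-bound-arithmetic a b n m a+m≤b+n 3n≤2a = NP.+-cancelʳ-≤ (2 * a) a (3 * b) (begin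
    a + 2 * a        ≡⟨⟩
    3 * a            ≤⟨ NP.*-monoʳ-≤ 3 (≤-trans (NP.m≤m+n a m) a+m≤b+n) ⟩
    3 * (b + n)      ≡⟨ NP.*-distribˡ-+ 3 b n ⟩
    3 * b + 3 * n    ≤⟨ NP.+-monoʳ-≤ (3 * b) 3n≤2a ⟩
    3 * b + 2 * a    ∎)
  where open NP.≤-Reasoning

lemma3p5 : (H N : Graph) → MinDegreeAtLeast 3 H → TriangleFreeContractible H N →
    numEdges H ≤ 3 * numEdges N
lemma3p5 H N min-deg contractible =
  edge-bound-arithmetic (numEdges H) (numEdges N) (order H) (order N)
    (edges-drop-along H N contractible)
    (min-degree-edges 3 H min-deg)
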